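{- Let $n\geq 1$ and let $\pi\in\mathcal{S}_n$ be a permutation with at most one descent. Then $\operatorname{des}(\pi^2)\leq 3$.
   Context: $\mathcal{S}_n$ is the symmetric group on $[n]=\{1,\ldots,n\}$; a permutation is written in one-line notation $\pi=\pi_1\pi_2\cdots\pi_n$ with $\pi_i=\pi(i)$. A descent of $\pi$ is an index $i$ with $1\leq i\leq n-1$ and $\pi_i>\pi_{i+1}$; $\operatorname{des}(\pi)$ is the number of descents. Powers are taken under composition: $\pi^2(i)=\pi(\pi(i))$. -}

module Defs where

open import Data.Nat using (ℕ; zero; suc)
open import Data.Fin using (Fin; inject₁; _<?_)
open import Data.Fin.Permutation using (Permutation′; _⟨$⟩ʳ_)
open import Data.List using (List; length; filter; allFin)

-- Positions 1..n-1 of one-line notation correspond to i : Fin m when n = suc m;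
-- position i (0-based: inject₁ i) and i+1 (0-based: suc i).
descentsF : {n : ℕ} → (Fin n → Fin n) → List ℕ
descentsF {zero} f = Data.List.[]
descentsF {suc m} f =
  Data.List.map Data.Fin.toℕ
    (filter (λ i → f (suc i) <? f (inject₁ i)) (allFin m))
  where open Data.Fin using (suc; toℕ)

desF : {n : ℕ} → (Fin n → Fin n) → ℕ
desF f = length (descentsF f)

des : {n : ℕ} → Permutation′ n → ℕ
des π = desF (π ⟨$⟩ʳ_)

square : {n : ℕ} → Permutation′ n → Permutation′ n
square π = π Data.Fin.Permutation.∘ₚ π

-- Extend π by the identity to g : ℕ → ℕ, which creates no new descents. If x is a descent of
-- g ∘ g but an ascent of g, then g ∘ g descends across [g x, g (x+1)], so g has a descent k there.
-- When g has only the descent k, two such x < y give g y ≤ k < g (x+1), hence a descent of g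
-- strictly between x and y, which must be k again. So at most two descents of g ∘ g are
-- ascents of g, and at most one is the descent of g.
module Submission where

open import Defs
open import Data.Nat using (ℕ; _≤_)
open import Data.Fin.Permutation using (Permutation′)

open import Data.Nat using (zero; suc; _<_; _<?_; z≤n; s≤s)
open import Data.Nat.Properties
open import Data.Fin as Fin using (Fin; toℕ; fromℕ<; inject₁)
open import Data.Fin.Properties using (toℕ<n; toℕ-fromℕ<; fromℕ<-toℕ; toℕ-inject₁)
open import Data.Fin.Permutation using (_⟨$⟩ʳ_)
open import Data.List using (List; []; _∷_; length; allFin)
open import Data.List.Membership.Propositional using (_∈_)
open import Data.List.Membership.Propositional.Properties using (∈-allFin; ∈-map∘filter⁻; ∈-map∘filter⁺)
open import Data.List.Relation.Unary.Any using (here)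
open import Data.List.Relation.Unary.All as All using (All; _∷_)
open import Data.List.Relation.Unary.AllPairs using (AllPairs; _∷_)
open import Data.List.Relation.Unary.AllPairs.Properties using (map⁺; filter⁺; tabulate⁺-<)
open import Data.Product using (_×_; _,_; ∃-syntax)
open import Data.Sum using (inj₁; inj₂)
open import Data.Empty using (⊥; ⊥-elim)
open import Function using (_∘_; id)
open import Relation.Nullary using (¬_; yes; no; contradiction)
open import Relation.Unary using (Decidable)
open import Relation.Binary.PropositionalEquality using (_≡_; _≗_; refl; sym; trans; cong; subst; subst₂)

Descent : (ℕ → ℕ) → ℕ → Set
Descent g x = g (suc x) < g x

descent? : (g : ℕ → ℕ) → Decidable (Descent g)
descent? g x = g (suc x) <? g x

Descent-resp-≗ : ∀ {g h} → g ≗ h → ∀ {x} → Descent g x → Descent h x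
Descent-resp-≗ g≗h {x} = subst₂ _<_ (g≗h (suc x)) (g≗h x)

AtMostOneDescent : (ℕ → ℕ) → Set
AtMostOneDescent g = ∀ {a b} → Descent g a → Descent g b → a ≡ b

module _ (g : ℕ → ℕ) where

  descent-between : ∀ {p} q → p ≤ q → g q < g p → ∃[ k ] p ≤ k × k < q × Descent g k
  descent-between zero z≤n gq<gp = contradiction gq<gp (<-irrefl refl)
  descent-between (suc q) p≤1+q gq<gp with m≤n⇒m<n∨m≡n p≤1+q
  ... | inj₂ refl = contradiction gq<gp (<-irrefl refl)
  ... | inj₁ (s≤s p≤q) with descent? g q
  ...   | yes dq = q , p≤q , n<1+n q , dq
  ...   | no ¬dq with descent-between q p≤q (≤-<-trans (≮⇒≥ ¬dq) gq<gp)
  ...     | k , p≤k , k<q , dk = k , p≤k , m<n⇒m<1+n k<q , dk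

  -- g carries the ascent (x, x+1) to g x ≤ g (x+1), and g descends from there to g (g (x+1)) < g (g x).
  square-descent-at-ascent : ∀ {x} → Descent (g ∘ g) x → ¬ Descent g x →
                             ∃[ k ] Descent g k × g x ≤ k × k < g (suc x)
  square-descent-at-ascent {x} d² ¬d with descent-between (g (suc x)) (≮⇒≥ ¬d) d²
  ... | k , gx≤k , k<gx+1 , dk = k , dk , gx≤k , k<gx+1

  module _ (unique : AtMostOneDescent g) where

    -- Both ascents lead to the same descent k, so g y ≤ k < g (x+1) forces a descent in [x+1, y).
    descent-separates : ∀ {x y} → x < y →
                        Descent (g ∘ g) x → ¬ Descent g x →
                        Descent (g ∘ g) y → ¬ Descent g y →
                        ∃[ k ] Descent g k × x < k × k < y
    descent-separates {x} {y} x<y d²x ¬dx d²y ¬dy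
      with k , dk , _ , k<gx+1 ← square-descent-at-ascent d²x ¬dx
         | k′ , dk′ , gy≤k′ , _ ← square-descent-at-ascent d²y ¬dy
      with l , x<l , l<y , dl ← descent-between y x<y
                                  (≤-<-trans gy≤k′ (subst (_< g (suc x)) (unique dk dk′) k<gx+1))
      = l , dl , x<l , l<y

    no-three-square-descents-at-ascents : ∀ {x y z} → x < y → y < z →
      Descent (g ∘ g) x → Descent (g ∘ g) y → Descent (g ∘ g) z →
      ¬ Descent g x → ¬ Descent g y → ¬ Descent g z → ⊥
    no-three-square-descents-at-ascents {y = y} x<y y<z d²x d²y d²z ¬dx ¬dy ¬dz
      with descent-separates x<y d²x ¬dx d²y ¬dy | descent-separates y<z d²y ¬dy d²z ¬dz
    ... | k , dk , _ , k<y | k′ , dk′ , y<k′ , _ =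
      <-asym k<y (subst (y <_) (unique dk′ dk) y<k′)

    no-four-square-descents : ∀ {a b c d} → a < b → b < c → c < d →
      Descent (g ∘ g) a → Descent (g ∘ g) b → Descent (g ∘ g) c → Descent (g ∘ g) d → ⊥
    no-four-square-descents {a} {b} {c} a<b b<c c<d d²a d²b d²c d²d
      with descent? g a | descent? g b | descent? g c
    ... | yes da | _ | _ =
      no-three-square-descents-at-ascents b<c c<d d²b d²c d²d
        (<⇒≢ a<b ∘ unique da) (<⇒≢ a<c ∘ unique da) (<⇒≢ (<-trans a<c c<d) ∘ unique da)
      where a<c = <-trans a<b b<c
    ... | no ¬da | yes db | _ =
      no-three-square-descents-at-ascents (<-trans a<b b<c) c<d d²a d²c d²d
        ¬da (<⇒≢ b<c ∘ unique db) (<⇒≢ (<-trans b<c c<d) ∘ unique db)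
    ... | no ¬da | no ¬db | yes dc =
      no-three-square-descents-at-ascents a<b (<-trans b<c c<d) d²a d²b d²d
        ¬da ¬db (<⇒≢ c<d ∘ unique dc)
    ... | no ¬da | no ¬db | no ¬dc =
      no-three-square-descents-at-ascents a<b b<c d²a d²b d²c ¬da ¬db ¬dc

length≤1⇒∈-unique : ∀ {xs : List ℕ} {a b} → length xs ≤ 1 → a ∈ xs → b ∈ xs → a ≡ b
length≤1⇒∈-unique {_ ∷ []} _ (here refl) (here refl) = refl
length≤1⇒∈-unique {_ ∷ _ ∷ _} (s≤s ()) _ _

no-increasing-quadruple⇒length≤3 : ∀ {P : ℕ → Set} {xs} → AllPairs _<_ xs → All P xs →
  (∀ {a b c d} → a < b → b < c → c < d → P a → P b → P c → P d → ⊥) → length xs ≤ 3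
no-increasing-quadruple⇒length≤3 {xs = []} _ _ _ = z≤n
no-increasing-quadruple⇒length≤3 {xs = _ ∷ []} _ _ _ = s≤s z≤n
no-increasing-quadruple⇒length≤3 {xs = _ ∷ _ ∷ []} _ _ _ = s≤s (s≤s z≤n)
no-increasing-quadruple⇒length≤3 {xs = _ ∷ _ ∷ _ ∷ []} _ _ _ = s≤s (s≤s (s≤s z≤n))
no-increasing-quadruple⇒length≤3 {xs = _ ∷ _ ∷ _ ∷ _ ∷ _}
  ((a<b ∷ _) ∷ (b<c ∷ _) ∷ (c<d ∷ _) ∷ _) (pa ∷ pb ∷ pc ∷ pd ∷ _) no-quadruple =
  ⊥-elim (no-quadruple a<b b<c c<d pa pb pc pd)

-- No descent arises at position n - 1 or beyond, since every value at a position below n is below n.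
extend : ∀ {n} → (Fin n → Fin n) → ℕ → ℕ
extend {n} f x with x <? n
... | yes x<n = toℕ (f (fromℕ< x<n))
... | no _ = x

module _ {n} (f : Fin n → Fin n) where

  extend-toℕ : ∀ i → extend f (toℕ i) ≡ toℕ (f i)
  extend-toℕ i with toℕ i <? n
  ... | yes i<n = cong (toℕ ∘ f) (fromℕ<-toℕ i i<n)
  ... | no i≮n = contradiction (toℕ<n i) i≮n

  extend-≥ : ∀ {x} → ¬ x < n → extend f x ≡ x
  extend-≥ {x} x≮n with x <? n
  ... | yes x<n = contradiction x<n x≮n
  ... | no _ = refl

  extend-<1+ : ∀ {x} → n ≤ suc x → extend f x < suc x
  extend-<1+ {x} n≤1+x with x <? n
  ... | yes _ = <-≤-trans (toℕ<n _) n≤1+x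
  ... | no _ = n<1+n x

  descent-extend⇒1+<n : ∀ {x} → Descent (extend f) x → suc x < n
  descent-extend⇒1+<n {x} d = ≰⇒> λ n≤1+x →
    <-irrefl (extend-≥ (≤⇒≯ n≤1+x)) (<-trans d (extend-<1+ n≤1+x))

extend-∘ : ∀ {n} (f h : Fin n → Fin n) → extend (f ∘ h) ≗ extend f ∘ extend h
extend-∘ {n} f h x with x <? n
... | yes x<n = sym (extend-toℕ f (h (fromℕ< x<n)))
... | no x≮n = sym (extend-≥ f x≮n)

module _ {m} (f : Fin (suc m) → Fin (suc m)) where

  private
    fin-descent? : Decidable (λ i → f (Fin.suc i) Fin.< f (inject₁ i))
    fin-descent? i = f (Fin.suc i) Fin.<? f (inject₁ i)

    extend-toℕ-inject₁ : ∀ i → extend f (toℕ i) ≡ toℕ (f (inject₁ i))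
    extend-toℕ-inject₁ i = trans (cong (extend f) (sym (toℕ-inject₁ i))) (extend-toℕ f (inject₁ i))

  ∈-descentsF⇒descent : ∀ {x} → x ∈ descentsF f → Descent (extend f) x
  ∈-descentsF⇒descent x∈ with ∈-map∘filter⁻ toℕ fin-descent? {xs = allFin m} x∈
  ... | i , _ , refl , fi+1<fi =
    subst₂ _<_ (sym (extend-toℕ f (Fin.suc i))) (sym (extend-toℕ-inject₁ i)) fi+1<fi

  descent⇒∈-descentsF : ∀ {x} → Descent (extend f) x → x ∈ descentsF f
  descent⇒∈-descentsF {x} d = ∈-map∘filter⁺ toℕ fin-descent? (i , ∈-allFin i , sym toℕi≡x , fi+1<fi)
    where
      x<m = ≤-pred (descent-extend⇒1+<n f d)
      i = fromℕ< x<m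
      toℕi≡x = toℕ-fromℕ< x<m
      fi+1<fi : f (Fin.suc i) Fin.< f (inject₁ i)
      fi+1<fi = subst₂ _<_ (extend-toℕ f (Fin.suc i)) (extend-toℕ-inject₁ i)
                           (subst (Descent (extend f)) (sym toℕi≡x) d)

  descentsF-increasing : AllPairs _<_ (descentsF f)
  descentsF-increasing = map⁺ (filter⁺ fin-descent? (tabulate⁺-< id))

lemma2p1 : (n : ℕ) → 1 ≤ n → (π : Permutation′ n) → des π ≤ 1 → des (square π) ≤ 3
lemma2p1 (suc m) _ π des-π≤1 =
  no-increasing-quadruple⇒length≤3 (descentsF-increasing (f ∘ f))
    (All.tabulate (Descent-resp-≗ (extend-∘ f f) ∘ ∈-descentsF⇒descent (f ∘ f)))
    (no-four-square-descents (extend f) unique)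
  where
    f : Fin (suc m) → Fin (suc m)
    f = π ⟨$⟩ʳ_
    unique : AtMostOneDescent (extend f)
    unique da db = length≤1⇒∈-unique des-π≤1 (descent⇒∈-descentsF f da) (descent⇒∈-descentsF f db)
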